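{- Let $T$ be a finite tree. Then $T$ has a difference-1 colouring if and only if its reduced form is (isomorphic to) the path $P_2$ on two vertices.
   Context: A colouring of a graph $G$ is a map $c:E(G)\to\{\text{blue},\text{red}\}$; it is a difference-1 colouring if at every vertex $v$ the number of incident blue edges minus the number of incident red edges equals $1$. A leaf is a vertex of degree $1$. A twig is a configuration of three vertices: a vertex $b$ of degree $3$ (the base) together with two leaves adjacent to $b$. A leaf-twig configuration at a vertex $v$ consists of four vertices distinct from $v$: a leaf $\ell$ and a twig with base $b$ (and its two leaves), where $\ell$ and $b$ are both adjacent to $v$. Removing a leaf-twig configuration means deleting these four vertices and their four incident edges. The reduced form of $G$ is the graph obtained by repeatedly removing leaf-twig configurations until none remain (the paper notes this is determined up to isomorphism). -}

module Defs where

open import Data.Nat using (ℕ; zero; suc; _+_)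
open import Data.Bool using (Bool; true; false; _∧_; not)
open import Data.Fin using (Fin)
open import Data.List using (List; []; _∷_; _++_; allFin; filterᵇ; length)
open import Data.List.Relation.Unary.Linked using (Linked)
open import Data.List.Relation.Unary.Unique.Propositional using (Unique)
open import Data.Product using (Σ; ∃; _×_; _,_)
open import Data.Empty using (⊥)
open import Relation.Nullary using (¬_)
open import Relation.Binary.PropositionalEquality using (_≡_; _≢_)
open import Function.Bundles using (_↔_; Inverse)
open import Function.Definitions using (Injective)

record Graph (n : ℕ) : Set where
  field
    adj    : Fin n → Fin n → Bool
    sym    : ∀ u v → adj u v ≡ adj v u
    irrefl : ∀ v → adj v v ≡ false
open Graph public

Adj : ∀ {n} → Graph n → Fin n → Fin n → Set
Adj G u v = adj G u v ≡ true

deg : ∀ {n} → Graph n → Fin n → ℕ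
deg {n} G v = length (filterᵇ (adj G v) (allFin n))

data Reach {n} (G : Graph n) : Fin n → Fin n → Set where
  here : ∀ {u} → Reach G u u
  step : ∀ {u w v} → Adj G u w → Reach G w v → Reach G u v

Connected : ∀ {n} → Graph n → Set
Connected G = ∀ u v → Reach G u v

IsCycle : ∀ {n} → Graph n → List (Fin n) → Set
IsCycle G [] = ⊥
IsCycle G (_ ∷ []) = ⊥
IsCycle G (_ ∷ _ ∷ []) = ⊥
IsCycle G (x ∷ y ∷ z ∷ rest) =
  Unique (x ∷ y ∷ z ∷ rest) × Linked (Adj G) ((x ∷ y ∷ z ∷ rest) ++ (x ∷ []))

Acyclic : ∀ {n} → Graph n → Set
Acyclic G = ∀ cs → ¬ IsCycle G cs

IsTree : ∀ {n} → Graph n → Set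
IsTree {n} G = (n ≢ 0) × Connected G × Acyclic G

-- Colourings (true = blue, false = red).  A colouring is a map on edges,
-- represented as a function on ordered pairs that is symmetric on edges.

blueDeg : ∀ {n} → Graph n → (Fin n → Fin n → Bool) → Fin n → ℕ
blueDeg {n} G c v = length (filterᵇ (λ w → adj G v w ∧ c v w) (allFin n))

redDeg : ∀ {n} → Graph n → (Fin n → Fin n → Bool) → Fin n → ℕ
redDeg {n} G c v = length (filterᵇ (λ w → adj G v w ∧ not (c v w)) (allFin n))

IsDiff1Colouring : ∀ {n} → Graph n → (Fin n → Fin n → Bool) → Set
IsDiff1Colouring G c =
  (∀ u v → Adj G u v → c u v ≡ c v u) × (∀ v → blueDeg G c v ≡ redDeg G c v + 1)

HasDiff1Colouring : ∀ {n} → Graph n → Set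
HasDiff1Colouring {n} G = Σ (Fin n → Fin n → Bool) (IsDiff1Colouring G)

IsLeafTwig : ∀ {n} → Graph n → (v ℓ b l₁ l₂ : Fin n) → Set
IsLeafTwig G v ℓ b l₁ l₂ =
  Unique (v ∷ ℓ ∷ b ∷ l₁ ∷ l₂ ∷ []) ×
  deg G ℓ ≡ 1 × deg G l₁ ≡ 1 × deg G l₂ ≡ 1 × deg G b ≡ 3 ×
  Adj G v ℓ × Adj G v b × Adj G b l₁ × Adj G b l₂

HasLeafTwig : ∀ {n} → Graph n → Set
HasLeafTwig {n} G = ∃ λ v → ∃ λ ℓ → ∃ λ b → ∃ λ l₁ → ∃ λ l₂ → IsLeafTwig G v ℓ b l₁ l₂

-- H (on Fin m) is obtained from G (on Fin (m + 4)) by removing a leaf-twig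
-- configuration: f : Fin m → Fin (m+4) is an injective relabelling whose
-- image is exactly the set of vertices other than ℓ, b, l₁, l₂, and H is the
-- induced subgraph on that image.
RemovesLeafTwig : ∀ {m} → Graph (m + 4) → Graph m → Set
RemovesLeafTwig {m} G H =
  ∃ λ v → ∃ λ ℓ → ∃ λ b → ∃ λ l₁ → ∃ λ l₂ → IsLeafTwig G v ℓ b l₁ l₂ ×
  Σ (Fin m → Fin (m + 4)) λ f →
    Injective _≡_ _≡_ f ×
    (∀ i → f i ≢ ℓ × f i ≢ b × f i ≢ l₁ × f i ≢ l₂) ×
    (∀ x → x ≢ ℓ → x ≢ b → x ≢ l₁ → x ≢ l₂ → ∃ λ i → f i ≡ x) ×
    (∀ i j → adj H i j ≡ adj G (f i) (f j))

data Reduces : ∀ {n m} → Graph n → Graph m → Set where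
  done : ∀ {n} {G : Graph n} → Reduces G G
  more : ∀ {m k} {G : Graph (m + 4)} {H : Graph m} {K : Graph k} →
         RemovesLeafTwig G H → Reduces H K → Reduces G K

IsReducedFormOf : ∀ {n m} → Graph m → Graph n → Set
IsReducedFormOf H G = Reduces G H × ¬ HasLeafTwig H

Iso : ∀ {n m} → Graph n → Graph m → Set
Iso {n} {m} G H =
  Σ (Fin n ↔ Fin m) λ φ → ∀ u v → adj G u v ≡ adj H (Inverse.to φ u) (Inverse.to φ v)

P₂ : Graph 2
P₂ = record { adj = a ; sym = s ; irrefl = i }
  where
  a : Fin 2 → Fin 2 → Bool
  a Fin.zero Fin.zero = false
  a Fin.zero (Fin.suc Fin.zero) = true
  a (Fin.suc Fin.zero) Fin.zero = true
  a (Fin.suc Fin.zero) (Fin.suc Fin.zero) = false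
  s : ∀ u v → a u v ≡ a v u
  s Fin.zero Fin.zero = Relation.Binary.PropositionalEquality.refl
  s Fin.zero (Fin.suc Fin.zero) = Relation.Binary.PropositionalEquality.refl
  s (Fin.suc Fin.zero) Fin.zero = Relation.Binary.PropositionalEquality.refl
  s (Fin.suc Fin.zero) (Fin.suc Fin.zero) = Relation.Binary.PropositionalEquality.refl
  i : ∀ v → a v v ≡ false
  i Fin.zero = Relation.Binary.PropositionalEquality.refl
  i (Fin.suc Fin.zero) = Relation.Binary.PropositionalEquality.refl

-- In a difference-1 colouring deg v = 2·red(v) + 1 at every vertex. Hence the edge at a leaf is
-- blue, a twig base has exactly one red edge (the one leaving the twig), and removing a
-- leaf-twig configuration at v deletes one blue and one red edge at v. So colourings restrict
-- to, and extend from, the reduced graph, and it remains to see that a colourable tree T without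
-- leaf-twig configurations is P₂. Call a vertex small if it is a leaf or a twig base. If some
-- vertex is not small, acyclicity yields a non-small vertex w all of whose neighbours but one
-- are small; as T has no leaf-twig configuration, those neighbours are all leaves or all twig
-- bases, and counting the blue and red edges at w shows that w is small after all. A twig base
-- would then have a third neighbour that is a leaf (its edge would be both blue and red) or a
-- twig base (a leaf-twig configuration), so every vertex is a leaf and T is P₂.

module Submission where

open import Defs hiding (sym)
open import Data.Bool using (Bool; true; false; _∧_; not; T)
open import Data.Bool.Properties using (T-≡) renaming (_≟_ to _≟ᵇ_)
open import Data.Empty using (⊥-elim)
open import Data.Fin as Fin using (Fin)
open import Data.Fin.Properties using (any?) renaming (_≟_ to _≟ᶠ_)
open import Data.List using (List; []; _∷_; _++_; allFin; filterᵇ; length; map)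
open import Data.List.Membership.Propositional using (_∈_; _∉_)
open import Data.List.Membership.Propositional.Properties
  using (∈-filter⁺; ∈-filter⁻; ∈-allFin; ∈-map⁺; ∈-map⁻; ∈-++⁻; ∈-++⁺ˡ; ∈-++⁺ʳ)
open import Data.List.Properties using (length-removeAt′; length-++; length-map; length-tabulate; filter-≐; map-++)
open import Data.List.Relation.Binary.Subset.Propositional using (_⊆_)
open import Data.List.Relation.Unary.All using (All; []; _∷_)
open import Data.List.Relation.Unary.All.Properties using (¬Any⇒All¬)
import Data.List.Relation.Unary.All as All
open import Data.List.Relation.Unary.Any using (here; there; index; _─_)
open import Data.List.Relation.Unary.AllPairs using ([]; _∷_)
open import Data.List.Relation.Unary.Linked using (Linked; []; [-]; _∷_)
import Data.List.Relation.Unary.Linked as Linked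
import Data.List.Relation.Unary.Linked.Properties as Linked
open import Data.List.Relation.Unary.Unique.Propositional using (Unique)
open import Data.List.Relation.Unary.Unique.Propositional.Properties using (filter⁺; allFin⁺; map⁺; ++⁺)
open import Data.Nat using (ℕ; zero; suc; _+_; _≤_; _<_; z≤n; s≤s; _≟_; ⌊_/2⌋)
open import Data.Nat.Properties
  using (+-cancelˡ-≡; +-assoc; +-identityʳ; +-suc; +-comm; suc-injective; n≡⌊n+n/2⌋; n≢0⇒n>0; n≤0⇒n≡0;
         ≤-antisym; ≤-trans; ≤-refl; <-≤-trans; <-irrefl; 1+n≰n)
open import Data.Product using (∃; _×_; _,_; proj₁; proj₂)
open import Data.Sum using (_⊎_; inj₁; inj₂; [_,_]; swap)
open import Function using (id; _∘_; _⇔_; mk⇔; Equivalence; Inverse; mk↔ₛ′)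
open import Function.Definitions using (Injective)
open import Relation.Nullary using (¬_; Dec; yes; no)
open import Relation.Nullary.Decidable using (T?; ¬?; _×-dec_; _⊎-dec_; decidable-stable)
open import Relation.Binary.PropositionalEquality
  using (_≡_; _≢_; refl; sym; trans; cong; cong₂; subst; subst₂; module ≡-Reasoning)

private variable
  A : Set
  n m : ℕ

∧-≡-true⁻ : ∀ {a b} → a ∧ b ≡ true → a ≡ true × b ≡ true
∧-≡-true⁻ {true} {true} _ = refl , refl

∧-≡-true⁺ : ∀ {a b} → a ≡ true → b ≡ true → a ∧ b ≡ true
∧-≡-true⁺ refl refl = refl

+1-shift : ∀ d {a a′ r r′} → a ≡ d + a′ → r ≡ d + r′ → (a ≡ r + 1 ⇔ a′ ≡ r′ + 1)
+1-shift d {a} {a′} {r} {r′} a≡ r≡ = mk⇔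
  (λ a≡r+1 → +-cancelˡ-≡ d _ _ (trans (sym a≡) (trans a≡r+1 (trans (cong (_+ 1) r≡) (+-assoc d r′ 1)))))
  (λ a′≡r′+1 → trans a≡ (trans (cong (d +_) a′≡r′+1)
                 (trans (sym (+-assoc d r′ 1)) (cong (_+ 1) (sym r≡)))))

∈-─ : ∀ {x y : A} {xs} (x∈xs : x ∈ xs) → y ∈ xs → y ≢ x → y ∈ (xs ─ x∈xs)
∈-─ (here refl) (here refl)   y≢x = ⊥-elim (y≢x refl)
∈-─ (here refl) (there y∈xs)  y≢x = y∈xs
∈-─ (there x∈xs) (here refl)  y≢x = here refl
∈-─ (there x∈xs) (there y∈xs) y≢x = there (∈-─ x∈xs y∈xs y≢x)

Unique-⊆⇒length-≤ : {xs ys : List A} → Unique xs → xs ⊆ ys → length xs ≤ length ys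
Unique-⊆⇒length-≤ [] _ = z≤n
Unique-⊆⇒length-≤ {xs = x ∷ xs} {ys} (x∉xs ∷ u) xs⊆ys = begin
  suc (length xs)           ≤⟨ s≤s (Unique-⊆⇒length-≤ u xs⊆ys─x) ⟩
  suc (length (ys ─ x∈ys))  ≡⟨ length-removeAt′ ys (index x∈ys) ⟨
  length ys                 ∎
  where
  open Data.Nat.Properties.≤-Reasoning
  x∈ys = xs⊆ys (here refl)
  xs⊆ys─x : xs ⊆ (ys ─ x∈ys)
  xs⊆ys─x y∈xs = ∈-─ x∈ys (xs⊆ys (there y∈xs)) (All.lookup x∉xs y∈xs ∘ sym)

Unique⇒length≤ : {xs : List (Fin n)} → Unique xs → length xs ≤ n
Unique⇒length≤ {n} {xs} u =
  subst (length xs ≤_) (length-tabulate id) (Unique-⊆⇒length-≤ u (λ {z} _ → ∈-allFin z))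

prefixTo : ∀ {q : A} (ys : List A) → q ∈ ys → List A
prefixTo (y ∷ ys) (here _)  = y ∷ []
prefixTo (y ∷ ys) (there r) = y ∷ prefixTo ys r

All-prefixTo : ∀ {P : A → Set} {q : A} (ys : List A) (r : q ∈ ys) → All P ys → All P (prefixTo ys r)
All-prefixTo (y ∷ ys) (here _)  (py ∷ _)   = py ∷ []
All-prefixTo (y ∷ ys) (there r) (py ∷ pys) = py ∷ All-prefixTo ys r pys

Unique-prefixTo : ∀ {q : A} (ys : List A) (r : q ∈ ys) → Unique ys → Unique (prefixTo ys r)
Unique-prefixTo (y ∷ ys) (here _)  (_ ∷ _)      = [] ∷ []
Unique-prefixTo (y ∷ ys) (there r) (y∉ys ∷ u) = All-prefixTo ys r y∉ys ∷ Unique-prefixTo ys r u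

Linked-prefixTo-∷ʳ : ∀ {R : A → A → Set} {q w x : A} (ys : List A) (r : q ∈ ys) →
  Linked R (x ∷ ys) → R q w → Linked R (x ∷ prefixTo ys r ++ w ∷ [])
Linked-prefixTo-∷ʳ (y ∷ ys) (here refl) (Rxy ∷ _)  Rqw = Rxy ∷ Rqw ∷ [-]
Linked-prefixTo-∷ʳ (y ∷ ys) (there r)   (Rxy ∷ lk) Rqw = Rxy ∷ Linked-prefixTo-∷ʳ ys r lk Rqw

-- Counting

card : (Fin n → Bool) → ℕ
card {n} p = length (filterᵇ p (allFin n))

module _ (p : Fin n → Bool) where

  open import Data.List.Membership.DecPropositional (_≟ᶠ_ {n}) using (_∈?_)

  private
    support = filterᵇ p (allFin n)

  ∈-support⁺ : ∀ {x} → p x ≡ true → x ∈ support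
  ∈-support⁺ {x} px = ∈-filter⁺ (T? ∘ p) (∈-allFin x) (Equivalence.from T-≡ px)

  ∈-support⁻ : ∀ {x} → x ∈ support → p x ≡ true
  ∈-support⁻ x∈ = Equivalence.to T-≡ (proj₂ (∈-filter⁻ (T? ∘ p) {xs = allFin n} x∈))

  Unique-support : Unique support
  Unique-support = filter⁺ (T? ∘ p) (allFin⁺ n)

  card-≥ : {xs : List (Fin n)} → Unique xs → (∀ {x} → x ∈ xs → p x ≡ true) → length xs ≤ card p
  card-≥ u xs⊆p = Unique-⊆⇒length-≤ u (∈-support⁺ ∘ xs⊆p)

  card-≤ : {xs : List (Fin n)} → (∀ {x} → p x ≡ true → x ∈ xs) → card p ≤ length xs
  card-≤ p⊆xs = Unique-⊆⇒length-≤ Unique-support (p⊆xs ∘ ∈-support⁻)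

  card-≡ : {xs : List (Fin n)} → Unique xs → (∀ {x} → p x ≡ true → x ∈ xs) →
           (∀ {x} → x ∈ xs → p x ≡ true) → card p ≡ length xs
  card-≡ u p⊆xs xs⊆p = ≤-antisym (card-≤ p⊆xs) (card-≥ u xs⊆p)

  card-<⇒∃∉ : {xs : List (Fin n)} → length xs < card p → ∃ λ x → p x ≡ true × x ∉ xs
  card-<⇒∃∉ {xs} xs<p with any? (λ x → (p x ≟ᵇ true) ×-dec ¬? (x ∈? xs))
  ... | yes found = found
  ... | no none = ⊥-elim (<-irrefl refl (<-≤-trans xs<p (card-≤ p⊆xs)))
    where
    p⊆xs : ∀ {x} → p x ≡ true → x ∈ xs
    p⊆xs {x} px with x ∈? xs
    ... | yes x∈xs = x∈xs
    ... | no x∉xs = ⊥-elim (none (x , px , x∉xs))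

card-cong : {p q : Fin n → Bool} → (∀ x → p x ≡ q x) → card p ≡ card q
card-cong {p = p} {q} p≗q =
  cong length (filter-≐ (T? ∘ p) (T? ∘ q) ((λ {x} → subst T (p≗q x)) , (λ {x} → subst T (sym (p≗q x))))
                       (allFin _))

card-false : card {n} (λ _ → false) ≡ 0
card-false {n} = n≤0⇒n≡0 (card-≤ {n} (λ _ → false) {[]} (λ ()))

length-filterᵇ-∧-split : (p q : A → Bool) (xs : List A) →
  length (filterᵇ (λ x → p x ∧ q x) xs) + length (filterᵇ (λ x → p x ∧ not (q x)) xs) ≡
  length (filterᵇ p xs)
length-filterᵇ-∧-split p q [] = refl
length-filterᵇ-∧-split p q (x ∷ xs) with p x | q x
... | false | _     = length-filterᵇ-∧-split p q xs
... | true  | true  = cong suc (length-filterᵇ-∧-split p q xs)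
... | true  | false = trans (+-suc _ _) (cong suc (length-filterᵇ-∧-split p q xs))

card-∧-split : (p q : Fin n → Bool) → card (λ x → p x ∧ q x) + card (λ x → p x ∧ not (q x)) ≡ card p
card-∧-split p q = length-filterᵇ-∧-split p q (allFin _)

card-image : (p : Fin n → Bool) {f : Fin m → Fin n} → Injective _≡_ _≡_ f →
  {extra : List (Fin n)} → Unique extra → (∀ {y} → y ∈ extra → ∀ i → f i ≢ y) →
  (∀ {y} → p y ≡ true → y ∈ extra ⊎ ∃ λ i → f i ≡ y) → (∀ {y} → y ∈ extra → p y ≡ true) →
  card p ≡ length extra + card (p ∘ f)
card-image {m = m} p {f} f-inj {extra} u-extra extra∉f p⊆ extra⊆p = begin
  card p                                ≡⟨ card-≡ p u-ys p⊆ys ys⊆p ⟩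
  length ys                             ≡⟨ length-++ extra ⟩
  length extra + length (map f image)   ≡⟨ cong (length extra +_) (length-map f image) ⟩
  length extra + card (p ∘ f)           ∎
  where
  open ≡-Reasoning
  image = filterᵇ (p ∘ f) (allFin m)
  ys = extra ++ map f image
  u-ys : Unique ys
  u-ys = ++⁺ u-extra (map⁺ f-inj (Unique-support (p ∘ f))) disjoint
    where
    disjoint : ∀ {y} → ¬ (y ∈ extra × y ∈ map f image)
    disjoint (y∈extra , y∈fimage) with ∈-map⁻ f y∈fimage
    ... | i , _ , refl = extra∉f y∈extra i refl
  p⊆ys : ∀ {y} → p y ≡ true → y ∈ ys
  p⊆ys py with p⊆ py
  ... | inj₁ y∈extra = ∈-++⁺ˡ y∈extra
  ... | inj₂ (i , refl) = ∈-++⁺ʳ extra (∈-map⁺ f (∈-support⁺ (p ∘ f) py))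
  ys⊆p : ∀ {y} → y ∈ ys → p y ≡ true
  ys⊆p y∈ys with ∈-++⁻ extra y∈ys
  ... | inj₁ y∈extra = extra⊆p y∈extra
  ... | inj₂ y∈fimage with ∈-map⁻ f y∈fimage
  ... | i , i∈image , refl = ∈-support⁻ (p ∘ f) i∈image

-- Graphs

module GraphProperties (G : Graph n) where

  Adj-sym : ∀ {u v} → Adj G u v → Adj G v u
  Adj-sym {u} {v} u~v = trans (Graph.sym G v u) u~v

  Adj⇒≢ : ∀ {u v} → Adj G u v → u ≢ v
  Adj⇒≢ {u} u~u refl with trans (sym u~u) (irrefl G u)
  ... | ()

  IsLeaf : Fin n → Set
  IsLeaf x = deg G x ≡ 1

  IsTwigBase : Fin n → Set
  IsTwigBase b = deg G b ≡ 3 ×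
    ∃ λ l₁ → ∃ λ l₂ → l₁ ≢ l₂ × Adj G b l₁ × Adj G b l₂ × IsLeaf l₁ × IsLeaf l₂

  IsLeafOrTwigBase : Fin n → Set
  IsLeafOrTwigBase x = IsLeaf x ⊎ IsTwigBase x

  isLeaf? : ∀ x → Dec (IsLeaf x)
  isLeaf? x = deg G x ≟ 1

  isTwigBase? : ∀ b → Dec (IsTwigBase b)
  isTwigBase? b = (deg G b ≟ 3) ×-dec any? λ l₁ → any? λ l₂ →
    ¬? (l₁ ≟ᶠ l₂) ×-dec (adj G b l₁ ≟ᵇ true) ×-dec (adj G b l₂ ≟ᵇ true) ×-dec
    isLeaf? l₁ ×-dec isLeaf? l₂

  isLeafOrTwigBase? : ∀ x → Dec (IsLeafOrTwigBase x)
  isLeafOrTwigBase? x = isLeaf? x ⊎-dec isTwigBase? x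

  ∃-neighbour-∉ : ∀ {x} {xs : List (Fin n)} → length xs < deg G x → ∃ λ y → Adj G x y × y ∉ xs
  ∃-neighbour-∉ {x} = card-<⇒∃∉ (adj G x)

  leaf-neighbour-unique : ∀ {x a y} → IsLeaf x → Adj G x a → Adj G x y → y ≡ a
  leaf-neighbour-unique {x} {a} {y} leaf x~a x~y with y ≟ᶠ a
  ... | yes y≡a = y≡a
  ... | no y≢a with subst (2 ≤_) leaf (card-≥ (adj G x) ((y≢a ∷ []) ∷ [] ∷ []) y∷a⊆)
    where
    y∷a⊆ : ∀ {z} → z ∈ y ∷ a ∷ [] → Adj G x z
    y∷a⊆ (here refl) = x~y
    y∷a⊆ (there (here refl)) = x~a
  ... | s≤s ()

  deg3-neighbours : ∀ {x a b d y} → deg G x ≡ 3 → Adj G x a → Adj G x b → Adj G x d →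
    a ≢ b → a ≢ d → b ≢ d → Adj G x y → y ≡ a ⊎ y ≡ b ⊎ y ≡ d
  deg3-neighbours {x} {a} {b} {d} {y} deg3 x~a x~b x~d a≢b a≢d b≢d x~y
    with y ≟ᶠ a | y ≟ᶠ b | y ≟ᶠ d
  ... | yes y≡a | _       | _       = inj₁ y≡a
  ... | no _    | yes y≡b | _       = inj₂ (inj₁ y≡b)
  ... | no _    | no _    | yes y≡d = inj₂ (inj₂ y≡d)
  ... | no y≢a  | no y≢b  | no y≢d
    with subst (4 ≤_) deg3 (card-≥ (adj G x) (
           (y≢a ∷ y≢b ∷ y≢d ∷ []) ∷ (a≢b ∷ a≢d ∷ []) ∷ (b≢d ∷ []) ∷ [] ∷ []) four⊆)
    where
    four⊆ : ∀ {z} → z ∈ y ∷ a ∷ b ∷ d ∷ [] → Adj G x z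
    four⊆ (here refl) = x~y
    four⊆ (there (here refl)) = x~a
    four⊆ (there (there (here refl))) = x~b
    four⊆ (there (there (there (here refl)))) = x~d
  ... | s≤s (s≤s (s≤s ()))

  leafTwig : ∀ {v ℓ b l₁ l₂} → Adj G v ℓ → Adj G v b → IsLeaf ℓ → ¬ IsLeaf v → deg G b ≡ 3 →
    l₁ ≢ l₂ → Adj G b l₁ → Adj G b l₂ → IsLeaf l₁ → IsLeaf l₂ → IsLeafTwig G v ℓ b l₁ l₂
  leafTwig {v} {ℓ} {b} {l₁} {l₂} v~ℓ v~b ℓ-leaf v-nonleaf deg3 l₁≢l₂ b~l₁ b~l₂ l₁-leaf l₂-leaf =
      ( (Adj⇒≢ v~ℓ ∷ Adj⇒≢ v~b ∷ v≢leaf l₁-leaf ∷ v≢leaf l₂-leaf ∷ [])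
      ∷ (ℓ≢b ∷ ℓ≢twigLeaf b~l₁ l₁-leaf ∷ ℓ≢twigLeaf b~l₂ l₂-leaf ∷ [])
      ∷ (b≢leaf l₁-leaf ∷ b≢leaf l₂-leaf ∷ [])
      ∷ (l₁≢l₂ ∷ []) ∷ [] ∷ [])
    , ℓ-leaf , l₁-leaf , l₂-leaf , deg3 , v~ℓ , v~b , b~l₁ , b~l₂
    where
    v≢leaf : ∀ {l} → IsLeaf l → v ≢ l
    v≢leaf l-leaf refl = v-nonleaf l-leaf
    b≢leaf : ∀ {l} → IsLeaf l → b ≢ l
    b≢leaf l-leaf refl with trans (sym l-leaf) deg3
    ... | ()
    ℓ≢b : ℓ ≢ b
    ℓ≢b = b≢leaf ℓ-leaf ∘ sym
    ℓ≢twigLeaf : ∀ {l} → Adj G b l → IsLeaf l → ℓ ≢ l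
    ℓ≢twigLeaf b~l l-leaf refl = Adj⇒≢ v~b (leaf-neighbour-unique l-leaf (Adj-sym b~l) (Adj-sym v~ℓ))

  ≅P₂-if-all-leaves : Fin n → Connected G → (∀ x → IsLeaf x) → Iso G P₂
  ≅P₂-if-all-leaves u connected leaves = mk↔ₛ′ to from to∘from from∘to , adj-preserved
    where
    neighbour : ∃ λ w → Adj G u w × w ∉ []
    neighbour = ∃-neighbour-∉ (subst (0 <_) (sym (leaves u)) (s≤s z≤n))
    w : Fin n
    w = proj₁ neighbour
    u~w : Adj G u w
    u~w = proj₁ (proj₂ neighbour)

    reach-u-or-w : ∀ {a x} → Reach G a x → a ≡ u ⊎ a ≡ w → x ≡ u ⊎ x ≡ w
    reach-u-or-w here           a∈uw       = a∈uw
    reach-u-or-w (step a~b b⇝x) (inj₁ refl) = reach-u-or-w b⇝x (inj₂ (leaf-neighbour-unique (leaves u) u~w a~b))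
    reach-u-or-w (step a~b b⇝x) (inj₂ refl) =
      reach-u-or-w b⇝x (inj₁ (leaf-neighbour-unique (leaves w) (Adj-sym u~w) a~b))

    u-or-w : ∀ x → x ≡ u ⊎ x ≡ w
    u-or-w x = reach-u-or-w (connected u x) (inj₁ refl)

    to : Fin n → Fin 2
    to x with x ≟ᶠ u
    ... | yes _ = Fin.zero
    ... | no _  = Fin.suc Fin.zero

    from : Fin 2 → Fin n
    from Fin.zero           = u
    from (Fin.suc Fin.zero) = w

    to-u : to u ≡ Fin.zero
    to-u with u ≟ᶠ u
    ... | yes _   = refl
    ... | no u≢u = ⊥-elim (u≢u refl)

    to-w : to w ≡ Fin.suc Fin.zero
    to-w with w ≟ᶠ u
    ... | yes w≡u = ⊥-elim (Adj⇒≢ u~w (sym w≡u))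
    ... | no _    = refl

    to∘from : ∀ i → to (from i) ≡ i
    to∘from Fin.zero           = to-u
    to∘from (Fin.suc Fin.zero) = to-w

    from∘to : ∀ x → from (to x) ≡ x
    from∘to x with u-or-w x
    ... | inj₁ refl rewrite to-u = refl
    ... | inj₂ refl rewrite to-w = refl

    adj-preserved : ∀ x y → adj G x y ≡ adj P₂ (to x) (to y)
    adj-preserved x y with u-or-w x | u-or-w y
    ... | inj₁ refl | inj₁ refl rewrite to-u        = irrefl G u
    ... | inj₁ refl | inj₂ refl rewrite to-u | to-w = u~w
    ... | inj₂ refl | inj₁ refl rewrite to-u | to-w = Adj-sym u~w
    ... | inj₂ refl | inj₂ refl rewrite to-w        = irrefl G w

deg-Iso : {G : Graph n} {H : Graph m} → ((φ , _) : Iso G H) → ∀ u → deg G u ≡ deg H (Inverse.to φ u)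
deg-Iso {G = G} {H} (φ , adj-preserved) u = begin
  card (adj G u)                           ≡⟨ card-image (adj G u) from-injective {[]} [] (λ ()) onto (λ ()) ⟩
  card (adj G u ∘ from)                    ≡⟨ card-cong (λ w → adj-preserved u (from w)) ⟩
  card (λ w → adj H (to u) (to (from w)))  ≡⟨ card-cong (λ w → cong (adj H (to u)) (strictlyInverseˡ w)) ⟩
  card (adj H (to u))                      ∎
  where
  open ≡-Reasoning
  open Inverse φ
  from-injective : Injective _≡_ _≡_ from
  from-injective {i} {j} eq = trans (sym (strictlyInverseˡ i)) (trans (cong to eq) (strictlyInverseˡ j))
  onto : ∀ {y} → adj G u y ≡ true → _ ⊎ ∃ λ i → from i ≡ y
  onto {y} _ = inj₂ (to y , strictlyInverseʳ y)

deg-P₂ : ∀ x → deg P₂ x ≡ 1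
deg-P₂ Fin.zero           = refl
deg-P₂ (Fin.suc Fin.zero) = refl

-- Colourings

-- blueDeg G c and redDeg G c are definitionally degBy G c and degBy G (red c).
degBy : Graph n → (Fin n → Fin n → Bool) → Fin n → ℕ
degBy {n} G k v = card (λ w → adj G v w ∧ k v w)

red : (Fin n → Fin n → Bool) → Fin n → Fin n → Bool
red c x y = not (c x y)

Balanced : Graph n → (Fin n → Fin n → Bool) → Fin n → Set
Balanced G c v = blueDeg G c v ≡ redDeg G c v + 1

balanced-if-leaf-all-blue : {G : Graph n} {c : Fin n → Fin n → Bool} {x : Fin n} →
  deg G x ≡ 1 → (∀ y → Adj G x y → c x y ≡ true) → Balanced G c x
balanced-if-leaf-all-blue {n} {G} {c} {x} deg1 blue =
  trans (card-cong all-blue) (trans deg1 (cong (_+ 1) (sym (trans (card-cong no-red) (card-false {n})))))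
  where
  all-blue : ∀ y → adj G x y ∧ c x y ≡ adj G x y
  all-blue y with adj G x y in x~y
  ... | false = refl
  ... | true  = blue y x~y
  no-red : ∀ y → adj G x y ∧ not (c x y) ≡ false
  no-red y with adj G x y in x~y
  ... | false = refl
  ... | true  = cong not (blue y x~y)

allBlue-if-≅P₂ : {H : Graph m} → Iso H P₂ → IsDiff1Colouring H (λ _ _ → true)
allBlue-if-≅P₂ {H = H} iso@(φ , _) = (λ _ _ _ → refl) , λ u →
  balanced-if-leaf-all-blue {G = H} (trans (deg-Iso {G = H} {H = P₂} iso u) (deg-P₂ (Inverse.to φ u))) (λ _ _ → refl)

module Diff1Colouring {G : Graph n} {c : Fin n → Fin n → Bool} (col : IsDiff1Colouring G c) where

  open GraphProperties G

  blue+red≡deg : ∀ v → blueDeg G c v + redDeg G c v ≡ deg G v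
  blue+red≡deg v = card-∧-split (adj G v) (c v)

  blue≡1+red : ∀ v → blueDeg G c v ≡ suc (redDeg G c v)
  blue≡1+red v = trans (proj₂ col v) (+-comm (redDeg G c v) 1)

  deg≡1+2·red : ∀ v → deg G v ≡ suc (redDeg G c v + redDeg G c v)
  deg≡1+2·red v = trans (sym (blue+red≡deg v)) (cong (_+ redDeg G c v) (blue≡1+red v))

  leaf-if-blue≤1 : ∀ {v} → blueDeg G c v ≤ 1 → IsLeaf v
  leaf-if-blue≤1 {v} blue≤1 with redDeg G c v | blue≡1+red v | deg≡1+2·red v
  ... | zero  | _     | deg≡1 = deg≡1
  ... | suc _ | blue≡ | _ with subst (_≤ 1) blue≡ blue≤1
  ... | s≤s ()

  leaf⊎deg3-if-red≤1 : ∀ {v} → redDeg G c v ≤ 1 → IsLeaf v ⊎ deg G v ≡ 3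
  leaf⊎deg3-if-red≤1 {v} red≤1 with redDeg G c v | deg≡1+2·red v
  leaf⊎deg3-if-red≤1 _         | zero        | deg≡1 = inj₁ deg≡1
  leaf⊎deg3-if-red≤1 _         | suc zero    | deg≡3 = inj₂ deg≡3
  leaf⊎deg3-if-red≤1 (s≤s ()) | suc (suc _) | _

  redDeg-determined : ∀ {v d} → deg G v ≡ suc (d + d) → redDeg G c v ≡ d
  redDeg-determined {v} {d} deg≡ = begin
    r                 ≡⟨ n≡⌊n+n/2⌋ r ⟩
    ⌊ r + r /2⌋       ≡⟨ cong ⌊_/2⌋ (suc-injective (trans (sym (deg≡1+2·red v)) deg≡)) ⟩
    ⌊ d + d /2⌋       ≡⟨ n≡⌊n+n/2⌋ d ⟨
    d                 ∎
    where
    open ≡-Reasoning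
    r = redDeg G c v

  leaf-edge-blue : ∀ {x y} → IsLeaf y → Adj G x y → c x y ≡ true
  leaf-edge-blue {x} {y} y-leaf x~y with c y x in cyx
  ... | true = trans (proj₁ col x y x~y) cyx
  ... | false with subst (1 ≤_) (redDeg-determined {d = 0} y-leaf)
                   (card-≥ (λ w → adj G y w ∧ not (c y w)) ([] ∷ []) x-red)
    where
    x-red : ∀ {w} → w ∈ x ∷ [] → adj G y w ∧ not (c y w) ≡ true
    x-red (here refl) rewrite Adj-sym x~y | cyx = refl
  ... | ()

  twigBase-edge-red : ∀ {b l₁ l₂ w} → deg G b ≡ 3 → l₁ ≢ l₂ → Adj G b l₁ → Adj G b l₂ →
    IsLeaf l₁ → IsLeaf l₂ → Adj G b w → w ≢ l₁ → w ≢ l₂ → c b w ≡ false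
  twigBase-edge-red {b} {l₁} {l₂} {w} deg3 l₁≢l₂ b~l₁ b~l₂ l₁-leaf l₂-leaf b~w w≢l₁ w≢l₂
    with c b w in cbw
  ... | false = refl
  ... | true with subst (3 ≤_) blue≡2
                   (card-≥ (λ z → adj G b z ∧ c b z)
                           ((w≢l₁ ∷ w≢l₂ ∷ []) ∷ (l₁≢l₂ ∷ []) ∷ [] ∷ []) all-blue)
    where
    blue≡2 : blueDeg G c b ≡ 2
    blue≡2 = trans (blue≡1+red b) (cong suc (redDeg-determined {d = 1} deg3))
    all-blue : ∀ {z} → z ∈ w ∷ l₁ ∷ l₂ ∷ [] → adj G b z ∧ c b z ≡ true
    all-blue (here refl) rewrite b~w | cbw = refl
    all-blue (there (here refl)) rewrite b~l₁ | leaf-edge-blue l₁-leaf b~l₁ = refl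
    all-blue (there (there (here refl))) rewrite b~l₂ | leaf-edge-blue l₂-leaf b~l₂ = refl
  ... | s≤s (s≤s ())

  leaf-if-twigBase-neighbours : ∀ {w p} → (∀ y → Adj G w y → y ≢ p → IsTwigBase y) → IsLeaf w
  leaf-if-twigBase-neighbours {w} {p} twigBases with isLeaf? w
  ... | yes w-leaf = w-leaf
  ... | no w-nonleaf = leaf-if-blue≤1 (card-≤ _ {p ∷ []} blue⊆p)
    where
    blue⊆p : ∀ {z} → adj G w z ∧ c w z ≡ true → z ∈ p ∷ []
    blue⊆p {z} _ with z ≟ᶠ p | adj G w z in w~z | c w z in blue
    ... | yes z≡p | _    | _    = here z≡p
    ... | no z≢p  | true | true with twigBases z w~z z≢p
    ... | deg3 , l₁ , l₂ , l₁≢l₂ , z~l₁ , z~l₂ , l₁-leaf , l₂-leaf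
      with trans (sym blue) (trans (proj₁ col w z w~z)
             (twigBase-edge-red deg3 l₁≢l₂ z~l₁ z~l₂ l₁-leaf l₂-leaf (Adj-sym w~z)
               (λ { refl → w-nonleaf l₁-leaf }) (λ { refl → w-nonleaf l₂-leaf })))
    ... | ()

  leafOrTwigBase-if-leaf-neighbours : ∀ {w p} → (∀ y → Adj G w y → y ≢ p → IsLeaf y) → IsLeafOrTwigBase w
  leafOrTwigBase-if-leaf-neighbours {w} {p} leaves with leaf⊎deg3-if-red≤1 (card-≤ _ {p ∷ []} red⊆p)
    where
    red⊆p : ∀ {z} → adj G w z ∧ not (c w z) ≡ true → z ∈ p ∷ []
    red⊆p {z} _ with z ≟ᶠ p | adj G w z in w~z | c w z in red
    ... | yes z≡p | _    | _     = here z≡p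
    ... | no z≢p  | true | false with trans (sym red) (leaf-edge-blue (leaves z w~z z≢p) w~z)
    ... | ()
  ... | inj₁ w-leaf = inj₁ w-leaf
  ... | inj₂ deg3 with ∃-neighbour-∉ {xs = p ∷ []} (subst (1 <_) (sym deg3) (s≤s (s≤s z≤n)))
  ... | y₁ , w~y₁ , y₁∉ with ∃-neighbour-∉ {xs = p ∷ y₁ ∷ []} (subst (2 <_) (sym deg3) ≤-refl)
  ... | y₂ , w~y₂ , y₂∉ =
    inj₂ (deg3 , y₁ , y₂ , (λ y₁≡y₂ → y₂∉ (there (here (sym y₁≡y₂)))) , w~y₁ , w~y₂ ,
          leaves y₁ w~y₁ (y₁∉ ∘ here) , leaves y₂ w~y₂ (y₂∉ ∘ here))

-- Acyclic graphs

module AcyclicProperties {G : Graph n} (acyclic : Acyclic G) where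

  open GraphProperties G
  open import Data.List.Membership.DecPropositional (_≟ᶠ_ {n}) using (_∈?_)

  private
    previous : Fin n → List (Fin n) → Fin n
    previous w []      = w
    previous w (p ∷ _) = p

    no-chord : ∀ {w q} ps → Unique (w ∷ ps) → Linked (Adj G) (w ∷ ps) →
               q ∈ ps → q ≢ previous w ps → ¬ Adj G w q
    no-chord (p ∷ ps) _ _ (here q≡p) q≢p _ = q≢p q≡p
    no-chord {w} (p ∷ y ∷ ys) ((w≢p ∷ w∉ys) ∷ p∉ys ∷ u) (w~p ∷ lk) (there q∈ys) _ w~q =
      acyclic (w ∷ p ∷ prefixTo (y ∷ ys) q∈ys) (cycle q∈ys
        ((w≢p ∷ All-prefixTo (y ∷ ys) q∈ys w∉ys) ∷ All-prefixTo (y ∷ ys) q∈ys p∉ys ∷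
         Unique-prefixTo (y ∷ ys) q∈ys u)
        (w~p ∷ Linked-prefixTo-∷ʳ (y ∷ ys) q∈ys lk (Adj-sym w~q)))
      where
      cycle : ∀ (r : _ ∈ y ∷ ys) → let cs = w ∷ p ∷ prefixTo (y ∷ ys) r in
              Unique cs → Linked (Adj G) (cs ++ w ∷ []) → IsCycle G cs
      cycle (here _)  u lk = u , lk
      cycle (there _) u lk = u , lk

  module _ {P : Fin n → Set} (P? : ∀ x → Dec (P x)) where

    private
      Endpoint : Set
      Endpoint = ∃ λ w → ∃ λ p → P w × (∀ y → Adj G w y → y ≢ p → ¬ P y)

      -- Extend a non-backtracking walk through P; it cannot revisit a vertex (that would close a
      -- cycle), so within n steps it reaches a vertex with no further P-neighbour.
      walk : ∀ k w ps → n ≤ length ps + k → P w → Unique (w ∷ ps) → Linked (Adj G) (w ∷ ps) → Endpoint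
      walk k w ps n≤ Pw u lk
        with any? (λ q → (adj G w q ≟ᵇ true) ×-dec ¬? (q ≟ᶠ previous w ps) ×-dec P? q)
      ... | no none = w , previous w ps , Pw , λ y w~y y≢p Py → none (y , w~y , y≢p , Py)
      ... | yes (q , w~q , q≢p , Pq) with q ∈? ps
      ...   | yes q∈ps = ⊥-elim (no-chord ps u lk q∈ps q≢p w~q)
      ...   | no q∉ps = extend k n≤
        where
        extend : ∀ k → n ≤ length ps + k → Endpoint
        extend zero n≤ps = ⊥-elim (1+n≰n (≤-trans (Unique⇒length≤ u) (subst (n ≤_) (+-identityʳ _) n≤ps)))
        extend (suc k) n≤ = walk k q (w ∷ ps) (subst (n ≤_) (+-suc (length ps) k) n≤) Pq
          ((Adj⇒≢ (Adj-sym w~q) ∷ ¬Any⇒All¬ ps q∉ps) ∷ u) (Adj-sym w~q ∷ lk)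

    induced-endpoint : ∀ {x} → P x → ∃ λ w → ∃ λ p → P w × (∀ y → Adj G w y → y ≢ p → ¬ P y)
    induced-endpoint {x} Px = walk n x [] ≤-refl Px ([] ∷ []) [-]

-- Irreducible coloured trees

module Irreducible {G : Graph n} {c : Fin n → Fin n → Bool}
                   (col : IsDiff1Colouring G c) (irreducible : ¬ HasLeafTwig G) where

  open GraphProperties G
  open Diff1Colouring {G = G} col

  leafOrTwigBase-if-neighbours : ∀ {w p} → (∀ y → Adj G w y → y ≢ p → IsLeafOrTwigBase y) →
                                 IsLeafOrTwigBase w
  leafOrTwigBase-if-neighbours {w} {p} nbrs
    with isLeaf? w
       | any? (λ ℓ → (adj G w ℓ ≟ᵇ true) ×-dec ¬? (ℓ ≟ᶠ p) ×-dec isLeaf? ℓ)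
       | any? (λ t → (adj G w t ≟ᵇ true) ×-dec ¬? (t ≟ᶠ p) ×-dec isTwigBase? t)
  ... | yes w-leaf | _ | _ = inj₁ w-leaf
  ... | no w-nonleaf | yes (ℓ , w~ℓ , _ , ℓ-leaf)
      | yes (t , w~t , _ , deg3 , l₁ , l₂ , l₁≢l₂ , t~l₁ , t~l₂ , l₁-leaf , l₂-leaf) =
    ⊥-elim (irreducible (w , ℓ , t , l₁ , l₂ ,
      leafTwig w~ℓ w~t ℓ-leaf w-nonleaf deg3 l₁≢l₂ t~l₁ t~l₂ l₁-leaf l₂-leaf))
  ... | no _ | no no-leaf | _ = inj₁ (leaf-if-twigBase-neighbours twigBase)
    where
    twigBase : ∀ y → Adj G w y → y ≢ p → IsTwigBase y
    twigBase y w~y y≢p with nbrs y w~y y≢p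
    ... | inj₁ y-leaf = ⊥-elim (no-leaf (y , w~y , y≢p , y-leaf))
    ... | inj₂ y-twigBase = y-twigBase
  ... | no _ | yes _ | no no-twigBase = leafOrTwigBase-if-leaf-neighbours leaf
    where
    leaf : ∀ y → Adj G w y → y ≢ p → IsLeaf y
    leaf y w~y y≢p with nbrs y w~y y≢p
    ... | inj₁ y-leaf = y-leaf
    ... | inj₂ y-twigBase = ⊥-elim (no-twigBase (y , w~y , y≢p , y-twigBase))

  all-leafOrTwigBase : Acyclic G → ∀ x → IsLeafOrTwigBase x
  all-leafOrTwigBase acyclic x with isLeafOrTwigBase? x
  ... | yes x-small = x-small
  ... | no x-big with induced-endpoint (¬? ∘ isLeafOrTwigBase?) x-big
    where open AcyclicProperties acyclic
  ... | w , p , w-big , others = ⊥-elim (w-big (leafOrTwigBase-if-neighbours λ y w~y y≢p →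
          decidable-stable (isLeafOrTwigBase? y) (others y w~y y≢p)))

  ¬twigBase : Acyclic G → ∀ t → ¬ IsTwigBase t
  ¬twigBase acyclic t (deg3 , l₁ , l₂ , l₁≢l₂ , t~l₁ , t~l₂ , l₁-leaf , l₂-leaf)
    with ∃-neighbour-∉ {xs = l₁ ∷ l₂ ∷ []} (subst (2 <_) (sym deg3) ≤-refl)
  ... | y , t~y , y∉ with all-leafOrTwigBase acyclic y
  ... | inj₁ y-leaf
    with trans (sym (leaf-edge-blue y-leaf t~y))
           (twigBase-edge-red deg3 l₁≢l₂ t~l₁ t~l₂ l₁-leaf l₂-leaf t~y
                              (y∉ ∘ here) (y∉ ∘ there ∘ here))
  ... | ()
  ¬twigBase acyclic t (deg3 , l₁ , l₂ , l₁≢l₂ , t~l₁ , t~l₂ , l₁-leaf , l₂-leaf)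
    | y , t~y , y∉ | inj₂ (deg3′ , m₁ , m₂ , m₁≢m₂ , y~m₁ , y~m₂ , m₁-leaf , m₂-leaf) =
    irreducible (t , l₁ , y , m₁ , m₂ ,
      leafTwig t~l₁ t~y l₁-leaf t-nonleaf deg3′ m₁≢m₂ y~m₁ y~m₂ m₁-leaf m₂-leaf)
    where
    t-nonleaf : ¬ IsLeaf t
    t-nonleaf t-leaf with trans (sym deg3) t-leaf
    ... | ()

  all-leaves : Acyclic G → ∀ x → IsLeaf x
  all-leaves acyclic x with all-leafOrTwigBase acyclic x
  ... | inj₁ x-leaf = x-leaf
  ... | inj₂ x-twigBase = ⊥-elim (¬twigBase acyclic x x-twigBase)

  ≅P₂ : IsTree G → Iso G P₂
  ≅P₂ (n≢0 , connected , acyclic) =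
    ≅P₂-if-all-leaves (Fin.fromℕ< (n≢0⇒n>0 n≢0)) connected (all-leaves acyclic)

-- Removing a leaf-twig configuration

record LeafTwigRemoval (G : Graph (m + 4)) (H : Graph m) : Set where
  constructor removal
  field
    v ℓ b l₁ l₂     : Fin (m + 4)
    distinct        : Unique (v ∷ ℓ ∷ b ∷ l₁ ∷ l₂ ∷ [])
    ℓ-leaf          : deg G ℓ ≡ 1
    l₁-leaf         : deg G l₁ ≡ 1
    l₂-leaf         : deg G l₂ ≡ 1
    b-deg3          : deg G b ≡ 3
    v~ℓ             : Adj G v ℓ
    v~b             : Adj G v b
    b~l₁            : Adj G b l₁
    b~l₂            : Adj G b l₂
    embed           : Fin m → Fin (m + 4)
    embed-injective : Injective _≡_ _≡_ embed
    embed-avoids    : ∀ i → embed i ≢ ℓ × embed i ≢ b × embed i ≢ l₁ × embed i ≢ l₂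
    embed-onto      : ∀ x → x ≢ ℓ → x ≢ b → x ≢ l₁ → x ≢ l₂ → ∃ λ i → embed i ≡ x
    embed-adj       : ∀ i j → adj H i j ≡ adj G (embed i) (embed j)

fromRemovesLeafTwig : {G : Graph (m + 4)} {H : Graph m} → RemovesLeafTwig G H → LeafTwigRemoval G H
fromRemovesLeafTwig (v , ℓ , b , l₁ , l₂ ,
                     (distinct , ℓ-leaf , l₁-leaf , l₂-leaf , b-deg3 , v~ℓ , v~b , b~l₁ , b~l₂) ,
                     embed , embed-injective , embed-avoids , embed-onto , embed-adj) =
  removal v ℓ b l₁ l₂ distinct ℓ-leaf l₁-leaf l₂-leaf b-deg3 v~ℓ v~b b~l₁ b~l₂
          embed embed-injective embed-avoids embed-onto embed-adj

module Removal {G : Graph (m + 4)} {H : Graph m} (r : LeafTwigRemoval G H) where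

  open LeafTwigRemoval r
  open GraphProperties G

  private
    v≢l₁ : v ≢ l₁
    v≢l₁ with distinct
    ... | (_ ∷ _ ∷ v≢l₁ ∷ _) ∷ _ = v≢l₁
    v≢l₂ : v ≢ l₂
    v≢l₂ with distinct
    ... | (_ ∷ _ ∷ _ ∷ v≢l₂ ∷ _) ∷ _ = v≢l₂
    ℓ≢b : ℓ ≢ b
    ℓ≢b with distinct
    ... | _ ∷ (ℓ≢b ∷ _) ∷ _ = ℓ≢b
    l₁≢l₂ : l₁ ≢ l₂
    l₁≢l₂ with distinct
    ... | _ ∷ _ ∷ _ ∷ (l₁≢l₂ ∷ _) ∷ _ = l₁≢l₂

  Removed : Fin (m + 4) → Set
  Removed x = x ≡ ℓ ⊎ x ≡ b ⊎ x ≡ l₁ ⊎ x ≡ l₂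

  classify : ∀ x → Removed x ⊎ ∃ λ i → embed i ≡ x
  classify x with x ≟ᶠ ℓ | x ≟ᶠ b | x ≟ᶠ l₁ | x ≟ᶠ l₂
  ... | yes x≡ℓ | _ | _ | _ = inj₁ (inj₁ x≡ℓ)
  ... | no _ | yes x≡b | _ | _ = inj₁ (inj₂ (inj₁ x≡b))
  ... | no _ | no _ | yes x≡l₁ | _ = inj₁ (inj₂ (inj₂ (inj₁ x≡l₁)))
  ... | no _ | no _ | no _ | yes x≡l₂ = inj₁ (inj₂ (inj₂ (inj₂ x≡l₂)))
  ... | no x≢ℓ | no x≢b | no x≢l₁ | no x≢l₂ = inj₂ (embed-onto x x≢ℓ x≢b x≢l₁ x≢l₂)

  embed-¬removed : ∀ i → ¬ Removed (embed i)
  embed-¬removed i removed with embed-avoids i | removed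
  ... | ≢ℓ , _ , _ , _ | inj₁ ≡ℓ = ≢ℓ ≡ℓ
  ... | _ , ≢b , _ , _ | inj₂ (inj₁ ≡b) = ≢b ≡b
  ... | _ , _ , ≢l₁ , _ | inj₂ (inj₂ (inj₁ ≡l₁)) = ≢l₁ ≡l₁
  ... | _ , _ , _ , ≢l₂ | inj₂ (inj₂ (inj₂ ≡l₂)) = ≢l₂ ≡l₂

  removed-neighbour : ∀ {x y} → Removed x → Adj G x y → Removed y ⊎ y ≡ v
  removed-neighbour (inj₁ refl) ℓ~y = inj₂ (leaf-neighbour-unique ℓ-leaf (Adj-sym v~ℓ) ℓ~y)
  removed-neighbour (inj₂ (inj₁ refl)) b~y
    with deg3-neighbours b-deg3 (Adj-sym v~b) b~l₁ b~l₂ v≢l₁ v≢l₂ l₁≢l₂ b~y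
  ... | inj₁ y≡v = inj₂ y≡v
  ... | inj₂ (inj₁ y≡l₁) = inj₁ (inj₂ (inj₂ (inj₁ y≡l₁)))
  ... | inj₂ (inj₂ y≡l₂) = inj₁ (inj₂ (inj₂ (inj₂ y≡l₂)))
  removed-neighbour (inj₂ (inj₂ (inj₁ refl))) l₁~y =
    inj₁ (inj₂ (inj₁ (leaf-neighbour-unique l₁-leaf (Adj-sym b~l₁) l₁~y)))
  removed-neighbour (inj₂ (inj₂ (inj₂ refl))) l₂~y =
    inj₁ (inj₂ (inj₁ (leaf-neighbour-unique l₂-leaf (Adj-sym b~l₂) l₂~y)))

  image-neighbour : ∀ {i y} → embed i ≢ v → Adj G (embed i) y → ∃ λ j → embed j ≡ y
  image-neighbour {i} {y} i≢v i~y with classify y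
  ... | inj₂ in-image = in-image
  ... | inj₁ y-removed with removed-neighbour y-removed (Adj-sym i~y)
  ...   | inj₁ i-removed = ⊥-elim (embed-¬removed i i-removed)
  ...   | inj₂ i≡v = ⊥-elim (i≢v i≡v)

  v-neighbour : ∀ {y} → Adj G v y → y ≡ ℓ ⊎ y ≡ b ⊎ ∃ λ j → embed j ≡ y
  v-neighbour {y} v~y with classify y
  ... | inj₁ (inj₁ y≡ℓ) = inj₁ y≡ℓ
  ... | inj₁ (inj₂ (inj₁ y≡b)) = inj₂ (inj₁ y≡b)
  ... | inj₁ (inj₂ (inj₂ (inj₁ refl))) =
    ⊥-elim (Adj⇒≢ v~b (leaf-neighbour-unique l₁-leaf (Adj-sym b~l₁) (Adj-sym v~y)))
  ... | inj₁ (inj₂ (inj₂ (inj₂ refl))) =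
    ⊥-elim (Adj⇒≢ v~b (leaf-neighbour-unique l₂-leaf (Adj-sym b~l₂) (Adj-sym v~y)))
  ... | inj₂ in-image = inj₂ (inj₂ in-image)

  v′ : Fin m
  v′ = proj₁ (embed-onto v (Adj⇒≢ v~ℓ) (Adj⇒≢ v~b) v≢l₁ v≢l₂)

  embed-v′ : embed v′ ≡ v
  embed-v′ = proj₂ (embed-onto v (Adj⇒≢ v~ℓ) (Adj⇒≢ v~b) v≢l₁ v≢l₂)

  collapse : Fin (m + 4) → Fin m
  collapse x with classify x
  ... | inj₁ _ = v′
  ... | inj₂ (i , _) = i

  collapse-embed : ∀ i → collapse (embed i) ≡ i
  collapse-embed i with classify (embed i)
  ... | inj₁ removed = ⊥-elim (embed-¬removed i removed)
  ... | inj₂ (j , eq) = embed-injective eq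

  Adj-embed : ∀ {i j} → Adj H i j → Adj G (embed i) (embed j)
  Adj-embed {i} {j} i~j = trans (sym (embed-adj i j)) i~j

  collapse-Adj : ∀ {x y} → Adj G x y → collapse x ≡ collapse y ⊎ Adj H (collapse x) (collapse y)
  collapse-Adj {x} {y} x~y with classify x | classify y
  ... | inj₂ (i , refl) | inj₂ (j , refl) =
    inj₂ (trans (embed-adj i j) x~y)
  ... | inj₁ _ | inj₁ _ = inj₁ refl
  ... | inj₁ x-removed | inj₂ (j , refl) with removed-neighbour x-removed x~y
  ...   | inj₁ y-removed = ⊥-elim (embed-¬removed j y-removed)
  ...   | inj₂ y≡v = inj₁ (sym (embed-injective (trans y≡v (sym embed-v′))))
  collapse-Adj {x} {y} x~y | inj₂ (i , refl) | inj₁ y-removed with removed-neighbour y-removed (Adj-sym x~y)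
  ...   | inj₁ x-removed = ⊥-elim (embed-¬removed i x-removed)
  ...   | inj₂ x≡v = inj₁ (embed-injective (trans x≡v (sym embed-v′)))

  collapse-Reach : ∀ {x y} → Reach G x y → Reach H (collapse x) (collapse y)
  collapse-Reach here = here
  collapse-Reach (step x~y y⇝z) with collapse-Adj x~y
  ... | inj₁ same = subst (λ c → Reach H c _) (sym same) (collapse-Reach y⇝z)
  ... | inj₂ adjacent = step adjacent (collapse-Reach y⇝z)

  isTree : IsTree G → IsTree H
  isTree (_ , connected , acyclic) = m≢0 , connected′ , acyclic′
    where
    m≢0 : m ≢ 0
    m≢0 refl with v′
    ... | ()
    connected′ : Connected H
    connected′ i j =
      subst₂ (Reach H) (collapse-embed i) (collapse-embed j) (collapse-Reach (connected (embed i) (embed j)))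
    acyclic′ : Acyclic H
    acyclic′ (x ∷ y ∷ z ∷ zs) (unique , linked) =
      acyclic (map embed (x ∷ y ∷ z ∷ zs))
        (map⁺ embed-injective unique ,
         subst (Linked (Adj G)) (map-++ embed (x ∷ y ∷ z ∷ zs) (x ∷ []))
               (Linked.map⁺ (Linked.map Adj-embed linked)))

  module _ {k : Fin (m + 4) → Fin (m + 4) → Bool} {k′ : Fin m → Fin m → Bool}
           (agree : ∀ i j → k (embed i) (embed j) ≡ k′ i j) where

    private
      restrict : ∀ i → card ((λ w → adj G (embed i) w ∧ k (embed i) w) ∘ embed) ≡ degBy H k′ i
      restrict i = card-cong (λ j → cong₂ _∧_ (sym (embed-adj i j)) (agree i j))

    degBy-image : ∀ {i} → embed i ≢ v → degBy G k (embed i) ≡ degBy H k′ i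
    degBy-image {i} i≢v =
      trans (card-image _ embed-injective {[]} [] (λ ())
                        (inj₂ ∘ image-neighbour i≢v ∘ proj₁ ∘ ∧-≡-true⁻) (λ ()))
            (restrict i)

    private
      degBy-v-via : ∀ a → Removed a → adj G v a ∧ k v a ≡ true →
        (∀ {y} → adj G v y ∧ k v y ≡ true → y ∈ a ∷ [] ⊎ ∃ λ j → embed j ≡ y) →
        degBy G k v ≡ suc (degBy H k′ v′)
      degBy-v-via a a-removed a-counted support =
        trans (card-image _ embed-injective ([] ∷ []) a∉image support λ { (here refl) → a-counted })
              (cong suc (subst (λ x → card ((λ w → adj G x w ∧ k x w) ∘ embed) ≡ degBy H k′ v′)
                               embed-v′ (restrict v′)))
        where
        a∉image : ∀ {y} → y ∈ a ∷ [] → ∀ i → embed i ≢ y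
        a∉image (here refl) i embed-i≡a = embed-¬removed i (subst Removed (sym embed-i≡a) a-removed)

    degBy-v : k v ℓ ≡ not (k v b) → degBy G k v ≡ suc (degBy H k′ v′)
    degBy-v kℓ≡¬kb with k v b in kb
    ... | true = degBy-v-via b (inj₂ (inj₁ refl)) (∧-≡-true⁺ v~b kb) (only-b ∘ ∧-≡-true⁻)
      where
      only-b : ∀ {y} → Adj G v y × k v y ≡ true → y ∈ b ∷ [] ⊎ ∃ λ j → embed j ≡ y
      only-b (v~y , ky) with v-neighbour v~y
      ... | inj₁ refl with trans (sym ky) kℓ≡¬kb
      ...   | ()
      only-b _ | inj₂ (inj₁ y≡b) = inj₁ (here y≡b)
      only-b _ | inj₂ (inj₂ in-image) = inj₂ in-image
    ... | false = degBy-v-via ℓ (inj₁ refl) (∧-≡-true⁺ v~ℓ kℓ≡¬kb) (only-ℓ ∘ ∧-≡-true⁻)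
      where
      only-ℓ : ∀ {y} → Adj G v y × k v y ≡ true → y ∈ ℓ ∷ [] ⊎ ∃ λ j → embed j ≡ y
      only-ℓ (v~y , ky) with v-neighbour v~y
      ... | inj₁ y≡ℓ = inj₁ (here y≡ℓ)
      ... | inj₂ (inj₁ refl) with trans (sym ky) kb
      ...   | ()
      only-ℓ _ | inj₂ (inj₂ in-image) = inj₂ in-image

  module _ {c : Fin (m + 4) → Fin (m + 4) → Bool} {c′ : Fin m → Fin m → Bool}
           (agree : ∀ i j → c (embed i) (embed j) ≡ c′ i j)
           (vℓ-blue : c v ℓ ≡ true) (vb-red : c v b ≡ false) where

    private
      exactly-one-blue : c v ℓ ≡ not (c v b)
      exactly-one-blue = trans vℓ-blue (cong not (sym vb-red))
      red-agree : ∀ i j → red c (embed i) (embed j) ≡ red c′ i j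
      red-agree i j = cong not (agree i j)

    balanced-image : ∀ i → Balanced G c (embed i) ⇔ Balanced H c′ i
    balanced-image i with embed i ≟ᶠ v
    ... | no i≢v = +1-shift 0 (degBy-image {k = c} agree i≢v) (degBy-image {k = red c} red-agree i≢v)
    ... | yes i≡v with embed-injective (trans i≡v (sym embed-v′))
    ... | refl = subst (λ x → Balanced G c x ⇔ Balanced H c′ v′) (sym embed-v′)
                   (+1-shift 1 (degBy-v {k = c} agree exactly-one-blue)
                               (degBy-v {k = red c} red-agree (cong not exactly-one-blue)))

  colouring-down : HasDiff1Colouring G → HasDiff1Colouring H
  colouring-down (c , col@(symmetric , balanced)) =
    (λ i j → c (embed i) (embed j)) ,
    (λ i j i~j → symmetric _ _ (Adj-embed i~j)) ,
    (λ i → Equivalence.to (balanced-image {c = c} (λ _ _ → refl) vℓ-blue vb-red i) (balanced (embed i)))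
    where
    open Diff1Colouring {G = G} col
    vℓ-blue : c v ℓ ≡ true
    vℓ-blue = leaf-edge-blue ℓ-leaf v~ℓ
    vb-red : c v b ≡ false
    vb-red = trans (symmetric v b v~b)
      (twigBase-edge-red b-deg3 l₁≢l₂ b~l₁ b~l₂ l₁-leaf l₂-leaf (Adj-sym v~b) v≢l₁ v≢l₂)

  TwigLeaf : Fin (m + 4) → Set
  TwigLeaf x = x ≡ ℓ ⊎ x ≡ l₁ ⊎ x ≡ l₂

  twigLeaf? : ∀ x → Dec (TwigLeaf x)
  twigLeaf? x = (x ≟ᶠ ℓ) ⊎-dec (x ≟ᶠ l₁) ⊎-dec (x ≟ᶠ l₂)

  embed-¬twigLeaf : ∀ i → ¬ TwigLeaf (embed i)
  embed-¬twigLeaf i (inj₁ ≡ℓ)         = embed-¬removed i (inj₁ ≡ℓ)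
  embed-¬twigLeaf i (inj₂ (inj₁ ≡l₁)) = embed-¬removed i (inj₂ (inj₂ (inj₁ ≡l₁)))
  embed-¬twigLeaf i (inj₂ (inj₂ ≡l₂)) = embed-¬removed i (inj₂ (inj₂ (inj₂ ≡l₂)))

  in-image : ∀ {x} → ¬ TwigLeaf x → x ≢ b → ∃ λ i → embed i ≡ x
  in-image {x} ¬twigLeaf x≢b =
    embed-onto x (¬twigLeaf ∘ inj₁) x≢b (¬twigLeaf ∘ inj₂ ∘ inj₁) (¬twigLeaf ∘ inj₂ ∘ inj₂)

  lift : (Fin m → Fin m → Bool) → Fin (m + 4) → Fin (m + 4) → Bool
  lift c′ x y with twigLeaf? x ⊎-dec twigLeaf? y | (x ≟ᶠ b) ⊎-dec (y ≟ᶠ b)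
  ... | yes _ | _     = true
  ... | no _  | yes _ = false
  ... | no _  | no _  = c′ (collapse x) (collapse y)

  module _ (c′ : Fin m → Fin m → Bool) where

    lift-twigLeaf : ∀ {x y} → TwigLeaf x ⊎ TwigLeaf y → lift c′ x y ≡ true
    lift-twigLeaf {x} {y} twigLeaf with twigLeaf? x ⊎-dec twigLeaf? y | (x ≟ᶠ b) ⊎-dec (y ≟ᶠ b)
    ... | yes _ | _ = refl
    ... | no ¬twigLeaf | _ = ⊥-elim (¬twigLeaf twigLeaf)

    lift-b : ∀ {x y} → ¬ (TwigLeaf x ⊎ TwigLeaf y) → x ≡ b ⊎ y ≡ b → lift c′ x y ≡ false
    lift-b {x} {y} ¬twigLeaf at-b with twigLeaf? x ⊎-dec twigLeaf? y | (x ≟ᶠ b) ⊎-dec (y ≟ᶠ b)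
    ... | yes twigLeaf | _ = ⊥-elim (¬twigLeaf twigLeaf)
    ... | no _ | yes _ = refl
    ... | no _ | no ¬at-b = ⊥-elim (¬at-b at-b)

    lift-embed : ∀ i j → lift c′ (embed i) (embed j) ≡ c′ i j
    lift-embed i j with twigLeaf? (embed i) ⊎-dec twigLeaf? (embed j) | (embed i ≟ᶠ b) ⊎-dec (embed j ≟ᶠ b)
    ... | yes twigLeaf | _ = ⊥-elim ([ embed-¬twigLeaf i , embed-¬twigLeaf j ] twigLeaf)
    ... | no _ | yes at-b = ⊥-elim ([ proj₁ (proj₂ (embed-avoids i)) , proj₁ (proj₂ (embed-avoids j)) ] at-b)
    ... | no _ | no _ = cong₂ c′ (collapse-embed i) (collapse-embed j)

    lift-symmetric : (∀ i j → Adj H i j → c′ i j ≡ c′ j i) →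
                     ∀ x y → Adj G x y → lift c′ x y ≡ lift c′ y x
    lift-symmetric symmetric x y x~y = by-cases (twigLeaf? x ⊎-dec twigLeaf? y) ((x ≟ᶠ b) ⊎-dec (y ≟ᶠ b))
      where
      by-cases : Dec (TwigLeaf x ⊎ TwigLeaf y) → Dec (x ≡ b ⊎ y ≡ b) → lift c′ x y ≡ lift c′ y x
      by-cases (yes twigLeaf) _ = trans (lift-twigLeaf twigLeaf) (sym (lift-twigLeaf (swap twigLeaf)))
      by-cases (no ¬twigLeaf) (yes at-b) = trans (lift-b ¬twigLeaf at-b) (sym (lift-b (¬twigLeaf ∘ swap) (swap at-b)))
      by-cases (no ¬twigLeaf) (no ¬at-b)
        with in-image (¬twigLeaf ∘ inj₁) (¬at-b ∘ inj₁) | in-image (¬twigLeaf ∘ inj₂) (¬at-b ∘ inj₂)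
      ... | i , refl | j , refl =
        trans (lift-embed i j) (trans (symmetric i j (trans (embed-adj i j) x~y)) (sym (lift-embed j i)))

  colouring-up : HasDiff1Colouring H → HasDiff1Colouring G
  colouring-up (c′ , symmetric′ , balanced′) = lift c′ , lift-symmetric c′ symmetric′ , balanced
    where
    vℓ-blue : lift c′ v ℓ ≡ true
    vℓ-blue = lift-twigLeaf c′ {v} (inj₂ (inj₁ refl))

    b-¬twigLeaf : ¬ TwigLeaf b
    b-¬twigLeaf (inj₁ b≡ℓ)         = ℓ≢b (sym b≡ℓ)
    b-¬twigLeaf (inj₂ (inj₁ b≡l₁)) = Adj⇒≢ b~l₁ b≡l₁
    b-¬twigLeaf (inj₂ (inj₂ b≡l₂)) = Adj⇒≢ b~l₂ b≡l₂

    v-¬twigLeaf : ¬ TwigLeaf v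
    v-¬twigLeaf (inj₁ v≡ℓ)         = Adj⇒≢ v~ℓ v≡ℓ
    v-¬twigLeaf (inj₂ (inj₁ v≡l₁)) = v≢l₁ v≡l₁
    v-¬twigLeaf (inj₂ (inj₂ v≡l₂)) = v≢l₂ v≡l₂

    bv-red : lift c′ b v ≡ false
    bv-red = lift-b c′ [ b-¬twigLeaf , v-¬twigLeaf ] (inj₁ refl)

    vb-red : lift c′ v b ≡ false
    vb-red = lift-b c′ [ v-¬twigLeaf , b-¬twigLeaf ] (inj₂ refl)

    twigLeaf-balanced : ∀ {x} → deg G x ≡ 1 → TwigLeaf x → Balanced G (lift c′) x
    twigLeaf-balanced {x} deg1 twigLeaf =
      balanced-if-leaf-all-blue {G = G} {lift c′} deg1 (λ y _ → lift-twigLeaf c′ {x} {y} (inj₁ twigLeaf))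

    b-balanced : Balanced G (lift c′) b
    b-balanced = trans blue≡2 (cong (_+ 1) (sym red≡1))
      where
      blue≡2 : blueDeg G (lift c′) b ≡ 2
      blue≡2 = card-≡ _ ((l₁≢l₂ ∷ []) ∷ [] ∷ []) only-leaves
        λ { (here refl) → ∧-≡-true⁺ b~l₁ (lift-twigLeaf c′ {b} (inj₂ (inj₂ (inj₁ refl))))
          ; (there (here refl)) → ∧-≡-true⁺ b~l₂ (lift-twigLeaf c′ {b} (inj₂ (inj₂ (inj₂ refl)))) }
        where
        only-leaves : ∀ {y} → adj G b y ∧ lift c′ b y ≡ true → y ∈ l₁ ∷ l₂ ∷ []
        only-leaves {y} b~y∧blue with ∧-≡-true⁻ b~y∧blue
        ... | b~y , is-blue with deg3-neighbours b-deg3 (Adj-sym v~b) b~l₁ b~l₂ v≢l₁ v≢l₂ l₁≢l₂ b~y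
        ...   | inj₁ refl with trans (sym is-blue) bv-red
        ...     | ()
        only-leaves _ | _ | inj₂ (inj₁ y≡l₁) = here y≡l₁
        only-leaves _ | _ | inj₂ (inj₂ y≡l₂) = there (here y≡l₂)
      red≡1 : redDeg G (lift c′) b ≡ 1
      red≡1 = card-≡ _ ([] ∷ []) only-v λ { (here refl) → ∧-≡-true⁺ (Adj-sym v~b) (cong not bv-red) }
        where
        only-v : ∀ {y} → adj G b y ∧ not (lift c′ b y) ≡ true → y ∈ v ∷ []
        only-v {y} b~y∧red with ∧-≡-true⁻ b~y∧red
        ... | b~y , is-red with deg3-neighbours b-deg3 (Adj-sym v~b) b~l₁ b~l₂ v≢l₁ v≢l₂ l₁≢l₂ b~y
        ...   | inj₁ y≡v = here y≡v
        ...   | inj₂ (inj₁ refl)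
          with trans (sym is-red) (cong not (lift-twigLeaf c′ {b} (inj₂ (inj₂ (inj₁ refl)))))
        ...     | ()
        only-v _ | _ , is-red | inj₂ (inj₂ refl)
          with trans (sym is-red) (cong not (lift-twigLeaf c′ {b} (inj₂ (inj₂ (inj₂ refl)))))
        ...     | ()

    balanced : ∀ x → Balanced G (lift c′) x
    balanced x with classify x
    ... | inj₁ (inj₁ refl)                = twigLeaf-balanced ℓ-leaf (inj₁ refl)
    ... | inj₁ (inj₂ (inj₁ refl))         = b-balanced
    ... | inj₁ (inj₂ (inj₂ (inj₁ refl)))  = twigLeaf-balanced l₁-leaf (inj₂ (inj₁ refl))
    ... | inj₁ (inj₂ (inj₂ (inj₂ refl)))  = twigLeaf-balanced l₂-leaf (inj₂ (inj₂ refl))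
    ... | inj₂ (i , refl) =
      Equivalence.from (balanced-image {c = lift c′} (lift-embed c′) vℓ-blue vb-red i) (balanced′ i)

Reduces-isTree : {G : Graph n} {H : Graph m} → Reduces G H → IsTree G → IsTree H
Reduces-isTree done                   tree = tree
Reduces-isTree (more removes reduces) tree =
  Reduces-isTree reduces (Removal.isTree (fromRemovesLeafTwig removes) tree)

Reduces-colouring : {G : Graph n} {H : Graph m} → Reduces G H → HasDiff1Colouring G → HasDiff1Colouring H
Reduces-colouring done                   colouring = colouring
Reduces-colouring (more {G = G} {H} removes reduces) colouring =
  Reduces-colouring reduces (Removal.colouring-down (fromRemovesLeafTwig {G = G} {H} removes) colouring)

Reduces-colouring⁻ : {G : Graph n} {H : Graph m} → Reduces G H → HasDiff1Colouring H → HasDiff1Colouring G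
Reduces-colouring⁻ done                   colouring = colouring
Reduces-colouring⁻ (more {G = G} {H} removes reduces) colouring =
  Removal.colouring-up (fromRemovesLeafTwig {G = G} {H} removes) (Reduces-colouring⁻ reduces colouring)

mainTheorem3 : ∀ {n} (T : Graph n) → IsTree T →
    (HasDiff1Colouring T → ∀ {m} (H : Graph m) → IsReducedFormOf H T → Iso H P₂) ×
    ((∃ λ m → ∃ λ (H : Graph m) → IsReducedFormOf H T × Iso H P₂) → HasDiff1Colouring T)
mainTheorem3 T tree = colourable⇒P₂ , P₂⇒colourable
  where
  colourable⇒P₂ : HasDiff1Colouring T → ∀ {m} (H : Graph m) → IsReducedFormOf H T → Iso H P₂
  colourable⇒P₂ colouring H (reduces , irreducible) with Reduces-colouring reduces colouring
  ... | _ , col = Irreducible.≅P₂ {G = H} col irreducible (Reduces-isTree reduces tree)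

  P₂⇒colourable : (∃ λ m → ∃ λ (H : Graph m) → IsReducedFormOf H T × Iso H P₂) → HasDiff1Colouring T
  P₂⇒colourable (_ , H , (reduces , _) , H≅P₂) =
    Reduces-colouring⁻ reduces (_ , allBlue-if-≅P₂ {H = H} H≅P₂)
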